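{- Let $w\in\mathfrak{S}_n$ and $u\le w$. If $1\le j<k\le n$ and $t_{u(j),u(k)}u\le w$, then $e_{u(k)}-e_{u(j)}\in D_w(u)$.
   Context: Permutations are in one-line notation; $\le$ is Bruhat order, $\ell$ length, $t_{a,b}$ the transposition of $a,b$ ($t_{a,b}u$ swaps the values $a,b$ in $u$); $e_1,\dots,e_n$ the standard basis of $\mathbb{R}^n$. For $u\le w$: $\widetilde{E}_w(u)=\{(u(i),u(j)) : 1\le i<j\le n,\ t_{u(i),u(j)}u\le w,\ |\ell(u)-\ell(t_{u(i),u(j)}u)|=1\}$; with $(a,b)+(b,c)=(a,c)$, an element is decomposable if it is a sum of some other elements of $\widetilde{E}_w(u)$; $E_w(u)$ is the set of indecomposable elements; $D_w(u)$ is the cone spanned by $\{e_b-e_a : (a,b)\in E_w(u)\}$. -}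

module Defs where

open import Data.Nat as ℕ using (ℕ; zero; suc)
open import Data.Fin as Fin using (Fin; zero; suc; _≟_; _<?_)
open import Data.Fin.Permutation using (Permutation′; _⟨$⟩ʳ_; _∘ₚ_; transpose)
open import Data.Rational as ℚ using (ℚ; 0ℚ; 1ℚ)
open import Data.Product using (Σ; ∃; _×_; _,_)
open import Data.Sum using (_⊎_)
open import Data.Bool using (if_then_else_; _∧_)
open import Relation.Nullary using (¬_; does)
open import Relation.Binary.PropositionalEquality using (_≡_)

-- Permutations of {1..n} (encoded as Fin n), one-line notation u(i) = u ⟨$⟩ʳ i.
Perm : ℕ → Set
Perm n = Permutation′ n

_≈ₚ_ : ∀ {n} → Perm n → Perm n → Set
u ≈ₚ v = ∀ i → u ⟨$⟩ʳ i ≡ v ⟨$⟩ʳ i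

-- t_{a,b} u : swaps the VALUES a and b in u  (as a function: t_{a,b} ∘ u)
tr : ∀ {n} → Fin n → Fin n → Perm n → Perm n
tr a b u = u ∘ₚ transpose a b

sumℕ : ∀ {n} → (Fin n → ℕ) → ℕ
sumℕ {zero}  f = 0
sumℕ {suc n} f = f zero ℕ.+ sumℕ (λ i → f (suc i))

sumℚ : ∀ {n} → (Fin n → ℚ) → ℚ
sumℚ {zero}  f = 0ℚ
sumℚ {suc n} f = f zero ℚ.+ sumℚ (λ i → f (suc i))

len : ∀ {n} → Perm n → ℕ
len u = sumℕ (λ i → sumℕ (λ j →
  if does (i <? j) ∧ does ((u ⟨$⟩ʳ j) <? (u ⟨$⟩ʳ i)) then 1 else 0))

data _≤B_ {n} (u : Perm n) : Perm n → Set where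
  ≤B-refl : ∀ {w} → u ≈ₚ w → u ≤B w
  ≤B-step : ∀ {v w} (a b : Fin n) → u ≤B v → w ≈ₚ tr a b v →
            len v ℕ.< len w → u ≤B w

Etilde : ∀ {n} → Perm n → Perm n → Fin n → Fin n → Set
Etilde {n} w u a b =
  Σ (Fin n) λ i → Σ (Fin n) λ j →
    i Fin.< j × u ⟨$⟩ʳ i ≡ a × u ⟨$⟩ʳ j ≡ b ×
    tr a b u ≤B w ×
    (len (tr a b u) ≡ suc (len u) ⊎ len u ≡ suc (len (tr a b u)))

data Chain {n} (R : Fin n → Fin n → Set) : Fin n → Fin n → Set where
  one  : ∀ {a b} → R a b → Chain R a b
  cons : ∀ {a c b} → R a c → Chain R c b → Chain R a b

-- (a,b) is decomposable: a sum (a,c)+(c,…)+…+(…,b) of at least two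
-- elements of \tilde E_w(u), each different from (a,b)
Decomposable : ∀ {n} → Perm n → Perm n → Fin n → Fin n → Set
Decomposable {n} w u a b =
  Σ (Fin n) λ c → Other a c × Chain Other c b
  where
  Other : Fin n → Fin n → Set
  Other x y = Etilde w u x y × ¬ (x ≡ a × y ≡ b)

E : ∀ {n} → Perm n → Perm n → Fin n → Fin n → Set
E w u a b = Etilde w u a b × ¬ Decomposable w u a b

e : ∀ {n} → Fin n → Fin n → ℚ
e a k = if does (k ≟ a) then 1ℚ else 0ℚ

InCone : ∀ {n} → (Fin n → Fin n → Set) → (Fin n → ℚ) → Set
InCone {n} R v =
  Σ (Fin n → Fin n → ℚ) λ c →
    (∀ a b → 0ℚ ℚ.≤ c a b) ×
    (∀ a b → c a b ≡ 0ℚ ⊎ R a b) ×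
    (∀ k → v k ≡ sumℚ (λ a → sumℚ (λ b → c a b ℚ.* (e b k ℚ.- e a k))))

InD : ∀ {n} → Perm n → Perm n → (Fin n → ℚ) → Set
InD w u v = InCone (E w u) v

-- Induction on the gap k − j.  If some position m strictly between j and k carries a value
-- strictly between u(j) and u(k), then t_{u(j),u(m)}u and t_{u(m),u(k)}u lie below
-- t_{u(j),u(k)}u (if u(j) < u(k)) or below u (otherwise), hence below w, and
-- e_{u(k)} − e_{u(j)} is the sum of the two shorter roots.  If there is no such m, then
--   ℓ(t_{ab}v) = ℓ(v) + 1 + 2·#{m : i < m < j, a < v(m) < b}   (i < j, a = v(i) < v(j) = b)
-- shows that t_{u(j),u(k)} changes the length of u by exactly one, so (u(j), u(k)) ∈ Ẽ_w(u).
-- Either it is indecomposable and generates the cone, or it is a sum of elements of Ẽ_w(u)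
-- whose positions span shorter intervals.  Indecomposability is decidable because Bruhat order
-- is (search along length-decreasing steps) and chains in Ẽ_w(u) are short (positions increase).

module Submission where

open import Defs
open import Data.Nat as ℕ using (ℕ; zero; suc; _+_; _*_)
import Data.Nat.Properties as ℕP
open import Data.Nat.Tactic.RingSolver using (solve-∀)
open import Data.Fin as Fin using (Fin; zero; suc; _<_; _≟_; _<?_)
import Data.Fin.Properties as FinP
open import Data.Fin.Permutation using (_⟨$⟩ʳ_; _⟨$⟩ˡ_; inverseˡ)
open import Function.Bundles using (Injection)
open import Function.Properties.Inverse using (↔⇒↣)
import Data.Fin.Permutation.Components as PC
open import Data.Bool using (Bool; true; false; not; _∧_; _∨_; if_then_else_)
open import Data.Empty using (⊥-elim)
open import Function using (_∘_)
open import Data.Product using (Σ; ∃₂; _×_; _,_; proj₁; proj₂)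
open import Data.Sum using (_⊎_; inj₁; inj₂; [_,_]′)
open import Relation.Nullary using (¬_; Dec; yes; no; does; proof; Reflects; invert; contradiction)
open import Relation.Nullary.Decidable using (dec-true; dec-false; map′; _×-dec_; _⊎-dec_; ¬?)
open import Relation.Binary.Definitions using (tri<; tri≈; tri>)
open import Relation.Binary.PropositionalEquality
import Algebra.Properties.Semiring.Sum as SemiringSum
open import Algebra.Bundles using (CommutativeRing)
open import Data.Rational as ℚ using (ℚ; 0ℚ; 1ℚ; _-_)
import Data.Rational.Properties as QP
open import Data.Rational.Solver using (module +-*-Solver)
open +-*-Solver using (solve; _:+_; _:-_; _:=_)

-- Finite sums

module Σℕ = SemiringSum ℕP.+-*-semiring

sumℕ≡sum : ∀ {n} (f : Fin n → ℕ) → sumℕ f ≡ Σℕ.sum f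
sumℕ≡sum {zero}  f = refl
sumℕ≡sum {suc n} f = cong (f zero +_) (sumℕ≡sum (f ∘ suc))

sumℕ-cong : ∀ {n} {f g : Fin n → ℕ} → (∀ i → f i ≡ g i) → sumℕ f ≡ sumℕ g
sumℕ-cong {f = f} {g} f≗g =
  trans (sumℕ≡sum f) (trans (Σℕ.sum-cong-≗ f≗g) (sym (sumℕ≡sum g)))

sumℕ-+ : ∀ {n} (f g : Fin n → ℕ) → sumℕ (λ i → f i + g i) ≡ sumℕ f + sumℕ g
sumℕ-+ f g = begin
  sumℕ (λ i → f i + g i)    ≡⟨ sumℕ≡sum (λ i → f i + g i) ⟩
  Σℕ.sum (λ i → f i + g i)  ≡⟨ Σℕ.∑-distrib-+ f g ⟩
  Σℕ.sum f + Σℕ.sum g       ≡⟨ sym (cong₂ _+_ (sumℕ≡sum f) (sumℕ≡sum g)) ⟩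
  sumℕ f + sumℕ g           ∎
  where open ≡-Reasoning

*-distribˡ-sumℕ : ∀ {n} k (f : Fin n → ℕ) → k * sumℕ f ≡ sumℕ (λ i → k * f i)
*-distribˡ-sumℕ k f = begin
  k * sumℕ f                ≡⟨ cong (k *_) (sumℕ≡sum f) ⟩
  k * Σℕ.sum f              ≡⟨ Σℕ.*-distribˡ-sum k f ⟩
  Σℕ.sum (λ i → k * f i)    ≡⟨ sym (sumℕ≡sum (λ i → k * f i)) ⟩
  sumℕ (λ i → k * f i)      ∎
  where open ≡-Reasoning

sumℕ-zero : ∀ {n} → sumℕ {n} (λ _ → 0) ≡ 0
sumℕ-zero {n} = trans (sumℕ≡sum {n} (λ _ → 0)) (Σℕ.sum-replicate-zero n)

onlyAt : ∀ {n} → Fin n → (Fin n → ℕ) → Fin n → ℕ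
onlyAt i g q = if does (q ≟ i) then g q else 0

outside : ∀ {n} → Fin n → Fin n → (Fin n → ℕ) → Fin n → ℕ
outside i j g q = if does (q ≟ i) ∨ does (q ≟ j) then 0 else g q

sumℕ-onlyAt : ∀ {n} (i : Fin n) (g : Fin n → ℕ) → sumℕ (onlyAt i g) ≡ g i
sumℕ-onlyAt {suc n} zero    g = trans (cong (g zero +_) (sumℕ-zero {n})) (ℕP.+-identityʳ (g zero))
sumℕ-onlyAt {suc n} (suc i) g = sumℕ-onlyAt i (g ∘ suc)

outside-+ : ∀ {n} (i j : Fin n) (f g : Fin n → ℕ) q →
            outside i j (λ m → f m + g m) q ≡ outside i j f q + outside i j g q
outside-+ i j f g q with does (q ≟ i) ∨ does (q ≟ j)
... | true  = refl
... | false = refl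

outside-cong : ∀ {n} (i j : Fin n) (f g : Fin n → ℕ) q → (q ≢ i → q ≢ j → f q ≡ g q) →
               outside i j f q ≡ outside i j g q
outside-cong i j f g q fq≡gq with q ≟ i | q ≟ j
... | yes _   | _       = refl
... | no _    | yes _   = refl
... | no q≢i  | no q≢j  = fq≡gq q≢i q≢j

sumℕ-outside-+ : ∀ {n} (i j : Fin n) (f g : Fin n → ℕ) →
                 sumℕ (outside i j (λ m → f m + g m)) ≡ sumℕ (outside i j f) + sumℕ (outside i j g)
sumℕ-outside-+ i j f g = trans (sumℕ-cong (outside-+ i j f g)) (sumℕ-+ (outside i j f) (outside i j g))

module _ {n} {i j : Fin n} (i≢j : i ≢ j) where

  split-at : ∀ (g : Fin n → ℕ) q → g q ≡ outside i j g q + onlyAt i g q + onlyAt j g q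
  split-at g q with q ≟ i | q ≟ j
  ... | yes refl | yes refl = ⊥-elim (i≢j refl)
  ... | yes _    | no _     = sym (ℕP.+-identityʳ (g q))
  ... | no _     | yes _    = refl
  ... | no _     | no _     = sym (trans (ℕP.+-identityʳ _) (ℕP.+-identityʳ (g q)))

  sumℕ-split : ∀ (g : Fin n → ℕ) → sumℕ g ≡ sumℕ (outside i j g) + g i + g j
  sumℕ-split g = begin
    sumℕ g
      ≡⟨ sumℕ-cong (split-at g) ⟩
    sumℕ (λ q → outside i j g q + onlyAt i g q + onlyAt j g q)
      ≡⟨ sumℕ-+ _ (onlyAt j g) ⟩
    sumℕ (λ q → outside i j g q + onlyAt i g q) + sumℕ (onlyAt j g)
      ≡⟨ cong₂ _+_ (sumℕ-+ (outside i j g) (onlyAt i g)) (sumℕ-onlyAt j g) ⟩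
    sumℕ (outside i j g) + sumℕ (onlyAt i g) + g j
      ≡⟨ cong (λ s → sumℕ (outside i j g) + s + g j) (sumℕ-onlyAt i g) ⟩
    sumℕ (outside i j g) + g i + g j ∎
    where open ≡-Reasoning

  sumℕ²-split : (F : Fin n → Fin n → ℕ) →
    sumℕ (λ p → sumℕ (F p)) ≡
      sumℕ (outside i j (λ p → sumℕ (outside i j (F p))))
      + sumℕ (outside i j (λ m → F i m + F j m + F m i + F m j))
      + (F i i + F i j + F j i + F j j)
  sumℕ²-split F = begin
    sumℕ (λ p → sumℕ (F p))
      ≡⟨ sumℕ-cong (λ p → sumℕ-split (F p)) ⟩
    sumℕ (λ p → S p + F p i + F p j)
      ≡⟨ trans (sumℕ-+ _ (λ p → F p j)) (cong (_+ sumℕ (λ p → F p j)) (sumℕ-+ S (λ p → F p i))) ⟩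
    sumℕ S + sumℕ (λ p → F p i) + sumℕ (λ p → F p j)
      ≡⟨ cong₂ _+_ (cong₂ _+_ (sumℕ-split S) (sumℕ-split (λ p → F p i))) (sumℕ-split (λ p → F p j)) ⟩
    (sumℕ (outside i j S) + S i + S j) + (sumℕ (outside i j (λ p → F p i)) + F i i + F j i)
      + (sumℕ (outside i j (λ p → F p j)) + F i j + F j j)
      ≡⟨ regroup (sumℕ (outside i j S)) (S i) (S j) (sumℕ (outside i j (λ p → F p i))) (F i i) (F j i)
                 (sumℕ (outside i j (λ p → F p j))) (F i j) (F j j) ⟩
    sumℕ (outside i j S)
      + (S i + S j + sumℕ (outside i j (λ p → F p i)) + sumℕ (outside i j (λ p → F p j)))
      + (F i i + F i j + F j i + F j j)
      ≡⟨ cong (λ s → sumℕ (outside i j S) + s + (F i i + F i j + F j i + F j j)) (sym cross) ⟩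
    sumℕ (outside i j S)
      + sumℕ (outside i j (λ m → F i m + F j m + F m i + F m j))
      + (F i i + F i j + F j i + F j j) ∎
    where
    open ≡-Reasoning
    S : Fin n → ℕ
    S p = sumℕ (outside i j (F p))
    regroup : ∀ a b c d e f g h k →
      (a + b + c) + (d + e + f) + (g + h + k) ≡ a + (b + c + d + g) + (e + h + f + k)
    regroup = solve-∀
    cross : sumℕ (outside i j (λ m → F i m + F j m + F m i + F m j))
          ≡ S i + S j + sumℕ (outside i j (λ p → F p i)) + sumℕ (outside i j (λ p → F p j))
    cross = begin
      sumℕ (outside i j (λ m → F i m + F j m + F m i + F m j))
        ≡⟨ sumℕ-outside-+ i j (λ m → F i m + F j m + F m i) (λ p → F p j) ⟩
      sumℕ (outside i j (λ m → F i m + F j m + F m i)) + sumℕ (outside i j (λ p → F p j))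
        ≡⟨ cong (_+ sumℕ (outside i j (λ p → F p j)))
                (sumℕ-outside-+ i j (λ m → F i m + F j m) (λ p → F p i)) ⟩
      sumℕ (outside i j (λ m → F i m + F j m)) + sumℕ (outside i j (λ p → F p i))
        + sumℕ (outside i j (λ p → F p j))
        ≡⟨ cong (λ s → s + sumℕ (outside i j (λ p → F p i)) + sumℕ (outside i j (λ p → F p j)))
                (sumℕ-outside-+ i j (F i) (F j)) ⟩
      S i + S j + sumℕ (outside i j (λ p → F p i)) + sumℕ (outside i j (λ p → F p j)) ∎

-- Comparisons and transpositions in Fin n

<?-true : ∀ {n} {x y : Fin n} → x < y → does (x <? y) ≡ true
<?-true {x = x} {y} = dec-true (x <? y)

<?-false : ∀ {n} {x y : Fin n} → ¬ x < y → does (x <? y) ≡ false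
<?-false {x = x} {y} = dec-false (x <? y)

<?-sound : ∀ {n} {x y : Fin n} → does (x <? y) ≡ true → x < y
<?-sound {x = x} {y} x<?y = invert (subst (Reflects (x < y)) x<?y (proof (x <? y)))

<?-flip : ∀ {n} {x y : Fin n} → x ≢ y → does (x <? y) ≡ not (does (y <? x))
<?-flip {x = x} {y} x≢y with FinP.<-cmp x y
... | tri< x<y _ _ = trans (<?-true x<y) (cong not (sym (<?-false (FinP.<-asym x<y))))
... | tri≈ _ x≡y _ = ⊥-elim (x≢y x≡y)
... | tri> _ _ y<x = trans (<?-false (FinP.<-asym y<x)) (cong not (sym (<?-true y<x)))

transpose-matchˡ : ∀ {n} (a b : Fin n) → PC.transpose a b a ≡ b
transpose-matchˡ a b rewrite dec-true (a ≟ a) refl = refl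

transpose-matchʳ : ∀ {n} (a b : Fin n) → PC.transpose a b b ≡ a
transpose-matchʳ a b with b ≟ a
... | yes b≡a = b≡a
... | no _ rewrite dec-true (b ≟ b) refl = refl

transpose-other : ∀ {n} {a b y : Fin n} → y ≢ a → y ≢ b → PC.transpose a b y ≡ y
transpose-other {a = a} {b} {y} y≢a y≢b rewrite dec-false (y ≟ a) y≢a | dec-false (y ≟ b) y≢b = refl

transpose-involutive : ∀ {n} (a b y : Fin n) → PC.transpose a b (PC.transpose a b y) ≡ y
transpose-involutive a b y = by-cases (y ≟ a) (y ≟ b)
  where
  by-cases : Dec (y ≡ a) → Dec (y ≡ b) → PC.transpose a b (PC.transpose a b y) ≡ y
  by-cases (yes refl) _ = trans (cong (PC.transpose a b) (transpose-matchˡ a b)) (transpose-matchʳ a b)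
  by-cases (no _) (yes refl) =
    trans (cong (PC.transpose a b) (transpose-matchʳ a b)) (transpose-matchˡ a b)
  by-cases (no y≢a) (no y≢b) =
    trans (cong (PC.transpose a b) (transpose-other y≢a y≢b)) (transpose-other y≢a y≢b)

transpose-conjugate : ∀ {n} (x y p q z : Fin n) →
  PC.transpose x y (PC.transpose p q (PC.transpose x y z)) ≡
  PC.transpose (PC.transpose x y p) (PC.transpose x y q) z
transpose-conjugate x y p q z = by-cases (σ z ≟ p) (σ z ≟ q)
  where
  σ = PC.transpose x y
  σσ : ∀ s → σ (σ s) ≡ s
  σσ = transpose-involutive x y
  by-cases : Dec (σ z ≡ p) → Dec (σ z ≡ q) →
             σ (PC.transpose p q (σ z)) ≡ PC.transpose (σ p) (σ q) z
  by-cases (yes refl) _ =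
    trans (cong σ (transpose-matchˡ (σ z) q))
          (sym (trans (cong (λ s → PC.transpose s (σ q) z) (σσ z)) (transpose-matchˡ z (σ q))))
  by-cases (no _) (yes refl) =
    trans (cong σ (transpose-matchʳ p (σ z)))
          (sym (trans (cong (PC.transpose (σ p) _) (sym (σσ z))) (transpose-matchʳ (σ p) (σ (σ z)))))
  by-cases (no σz≢p) (no σz≢q) =
    trans (cong σ (transpose-other σz≢p σz≢q))
          (trans (σσ z) (sym (transpose-other (λ z≡σp → σz≢p (trans (cong σ z≡σp) (σσ p)))
                                              (λ z≡σq → σz≢q (trans (cong σ z≡σq) (σσ q))))))

⟨$⟩ʳ-injective : ∀ {n} (v : Perm n) {x y} → v ⟨$⟩ʳ x ≡ v ⟨$⟩ʳ y → x ≡ y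
⟨$⟩ʳ-injective v = Injection.injective (↔⇒↣ v)

tr-conjugate : ∀ {n} (x y p q : Fin n) (v : Perm n) →
               tr x y (tr p q (tr x y v)) ≈ₚ tr (PC.transpose x y p) (PC.transpose x y q) v
tr-conjugate x y p q v i = transpose-conjugate x y p q (v ⟨$⟩ʳ i)

-- Inversions and the length of a transposed permutation

𝟙 : Bool → ℕ
𝟙 b = if b then 1 else 0

inversion : ∀ {n} → Perm n → Fin n → Fin n → ℕ
inversion v p q = 𝟙 (does (p <? q) ∧ does (v ⟨$⟩ʳ q <? v ⟨$⟩ʳ p))

-- p, q, r, s stand for [i < m], [j < m], [x < a], [x < b] where i < j and a < b
𝟙-cross-swap : ∀ p q r s → (q ≡ true → p ≡ true) → (r ≡ true → s ≡ true) →
  𝟙 (p ∧ s) + 𝟙 (q ∧ r) + 𝟙 (not p ∧ not s) + 𝟙 (not q ∧ not r) ≡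
  𝟙 (p ∧ r) + 𝟙 (q ∧ s) + 𝟙 (not p ∧ not r) + 𝟙 (not q ∧ not s) + 2 * 𝟙 (p ∧ not q ∧ not r ∧ s)
𝟙-cross-swap false false false false _ _ = refl
𝟙-cross-swap false false false true  _ _ = refl
𝟙-cross-swap false false true  s     _ r⇒s rewrite r⇒s refl = refl
𝟙-cross-swap false true  _     _     q⇒p _ with () ← q⇒p refl
𝟙-cross-swap true  false false false _ _ = refl
𝟙-cross-swap true  false false true  _ _ = refl
𝟙-cross-swap true  false true  s     _ r⇒s rewrite r⇒s refl = refl
𝟙-cross-swap true  true  false false _ _ = refl
𝟙-cross-swap true  true  false true  _ _ = refl
𝟙-cross-swap true  true  true  s     _ r⇒s rewrite r⇒s refl = refl

module TransposeLength {n} (v : Perm n) {i j : Fin n} (i<j : i < j)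
                       (vi<vj : v ⟨$⟩ʳ i < v ⟨$⟩ʳ j) where
  private
    a = v ⟨$⟩ʳ i
    b = v ⟨$⟩ʳ j
    v′ = tr a b v

    i≢j : i ≢ j
    i≢j = FinP.<⇒≢ i<j

    v′-other : ∀ m → m ≢ i → m ≢ j → v′ ⟨$⟩ʳ m ≡ v ⟨$⟩ʳ m
    v′-other m m≢i m≢j =
      transpose-other (m≢i ∘ ⟨$⟩ʳ-injective v) (m≢j ∘ ⟨$⟩ʳ-injective v)

  isBetween : Fin n → ℕ
  isBetween m = 𝟙 (does (i <? m) ∧ does (m <? j) ∧ does (a <? v ⟨$⟩ʳ m) ∧ does (v ⟨$⟩ʳ m <? b))

  private
    crossAt : Fin n → Fin n → Fin n → Fin n → ℕ
    crossAt m x y z = 𝟙 (does (i <? m) ∧ does (x <? y)) + 𝟙 (does (j <? m) ∧ does (x <? z))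
                    + 𝟙 (does (m <? i) ∧ does (y <? x)) + 𝟙 (does (m <? j) ∧ does (z <? x))

    cross : Perm n → Fin n → ℕ
    cross w m = crossAt m (w ⟨$⟩ʳ m) (w ⟨$⟩ʳ i) (w ⟨$⟩ʳ j)

    crossAt-swap : ∀ m → m ≢ i → m ≢ j →
                   crossAt m (v ⟨$⟩ʳ m) b a ≡ crossAt m (v ⟨$⟩ʳ m) a b + 2 * isBetween m
    crossAt-swap m m≢i m≢j
      rewrite <?-flip m≢i | <?-flip m≢j
            | <?-flip {x = a} (m≢i ∘ ⟨$⟩ʳ-injective v ∘ sym)
            | <?-flip {x = b} (m≢j ∘ ⟨$⟩ʳ-injective v ∘ sym)
      = 𝟙-cross-swap (does (i <? m)) (does (j <? m)) (does (x <? a)) (does (x <? b))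
          (λ j<m → <?-true {x = i} (FinP.<-trans i<j (<?-sound {x = j} {y = m} j<m)))
          (λ x<a → <?-true {y = b} (FinP.<-trans (<?-sound {x = x} {y = a} x<a) vi<vj))
      where x = v ⟨$⟩ʳ m

    cross-tr : ∀ m → outside i j (cross v′) m ≡ outside i j (cross v) m + 2 * outside i j isBetween m
    cross-tr m with m ≟ i | m ≟ j
    ... | yes _   | _      = refl
    ... | no _    | yes _  = refl
    ... | no m≢i  | no m≢j = begin
      crossAt m (v′ ⟨$⟩ʳ m) (v′ ⟨$⟩ʳ i) (v′ ⟨$⟩ʳ j)
        ≡⟨ cong (λ x → crossAt m x _ _) (v′-other m m≢i m≢j) ⟩
      crossAt m (v ⟨$⟩ʳ m) (v′ ⟨$⟩ʳ i) (v′ ⟨$⟩ʳ j)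
        ≡⟨ cong₂ (crossAt m (v ⟨$⟩ʳ m)) (transpose-matchˡ a b) (transpose-matchʳ a b) ⟩
      crossAt m (v ⟨$⟩ʳ m) b a
        ≡⟨ crossAt-swap m m≢i m≢j ⟩
      crossAt m (v ⟨$⟩ʳ m) a b + 2 * isBetween m ∎
      where open ≡-Reasoning

    away : Perm n → ℕ
    away w = sumℕ (outside i j (λ p → sumℕ (outside i j (inversion w p))))

    inversion-away : ∀ {p q} → p ≢ i → p ≢ j → q ≢ i → q ≢ j → inversion v′ p q ≡ inversion v p q
    inversion-away {p} {q} p≢i p≢j q≢i q≢j =
      cong₂ (λ x y → 𝟙 (does (p <? q) ∧ does (x <? y))) (v′-other q q≢i q≢j) (v′-other p p≢i p≢j)

    away-tr : away v′ ≡ away v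
    away-tr = sumℕ-cong λ p →
      outside-cong i j (λ p → sumℕ (outside i j (inversion v′ p)))
                       (λ p → sumℕ (outside i j (inversion v p))) p
        λ p≢i p≢j → sumℕ-cong λ q →
          outside-cong i j (inversion v′ p) (inversion v p) q (inversion-away p≢i p≢j)

    diagonal : Perm n → ℕ
    diagonal w = inversion w i i + inversion w i j + inversion w j i + inversion w j j

    diagonal-v : diagonal v ≡ 0
    diagonal-v rewrite <?-false (FinP.<-irrefl {x = i} refl) | <?-false (FinP.<-irrefl {x = j} refl)
                     | <?-true i<j | <?-false (FinP.<-asym i<j) | <?-false (FinP.<-asym vi<vj) = refl

    diagonal-v′ : diagonal v′ ≡ 1
    diagonal-v′ rewrite <?-false (FinP.<-irrefl {x = i} refl) | <?-false (FinP.<-irrefl {x = j} refl)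
                      | <?-true i<j | <?-false (FinP.<-asym i<j)
                      | transpose-matchˡ a b | transpose-matchʳ a b | <?-true vi<vj = refl

  betweenCount : ℕ
  betweenCount = sumℕ (outside i j isBetween)

  len-tr : len v′ ≡ len v + suc (2 * betweenCount)
  len-tr = begin
    len v′
      ≡⟨ sumℕ²-split i≢j (inversion v′) ⟩
    away v′ + sumℕ (outside i j (cross v′)) + diagonal v′
      ≡⟨ cong₂ (λ s t → s + sumℕ (outside i j (cross v′)) + t) away-tr diagonal-v′ ⟩
    away v + sumℕ (outside i j (cross v′)) + 1
      ≡⟨ cong (λ s → away v + s + 1) crossSum ⟩
    away v + (C + 2 * betweenCount) + 1
      ≡⟨ regroup (away v) C betweenCount ⟩
    away v + C + 0 + suc (2 * betweenCount)
      ≡⟨ cong (λ s → away v + C + s + suc (2 * betweenCount)) (sym diagonal-v) ⟩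
    away v + C + diagonal v + suc (2 * betweenCount)
      ≡⟨ cong (_+ suc (2 * betweenCount)) (sym (sumℕ²-split i≢j (inversion v))) ⟩
    len v + suc (2 * betweenCount) ∎
    where
    open ≡-Reasoning
    C : ℕ
    C = sumℕ (outside i j (cross v))
    crossSum : sumℕ (outside i j (cross v′)) ≡ C + 2 * betweenCount
    crossSum = trans (sumℕ-cong cross-tr)
      (trans (sumℕ-+ (outside i j (cross v)) (λ m → 2 * outside i j isBetween m))
             (cong (C +_) (sym (*-distribˡ-sumℕ 2 (outside i j isBetween)))))
    regroup : ∀ x y z → x + (y + 2 * z) + 1 ≡ x + y + 0 + suc (2 * z)
    regroup = solve-∀

len-<-tr : ∀ {n} (v : Perm n) {i j : Fin n} → i < j → v ⟨$⟩ʳ i < v ⟨$⟩ʳ j →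
           len v ℕ.< len (tr (v ⟨$⟩ʳ i) (v ⟨$⟩ʳ j) v)
len-<-tr v i<j vi<vj =
  subst (len v ℕ.<_) (sym (TransposeLength.len-tr v i<j vi<vj)) (ℕP.m<m+n (len v) ℕ.z<s)

len-tr-cover : ∀ {n} (v : Perm n) {i j a b : Fin n} → v ⟨$⟩ʳ i ≡ a → v ⟨$⟩ʳ j ≡ b → i < j → a < b →
               (∀ m → ¬ (i < m × m < j × a < v ⟨$⟩ʳ m × v ⟨$⟩ʳ m < b)) →
               len (tr a b v) ≡ suc (len v)
len-tr-cover {n} v {i} {j} refl refl i<j vi<vj nothing-between = begin
  len (tr (v ⟨$⟩ʳ i) (v ⟨$⟩ʳ j) v) ≡⟨ len-tr ⟩
  len v + suc (2 * betweenCount)      ≡⟨ cong (λ c → len v + suc (2 * c)) betweenCount≡0 ⟩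
  len v + 1                        ≡⟨ ℕP.+-comm (len v) 1 ⟩
  suc (len v)                      ∎
  where
  open ≡-Reasoning
  open TransposeLength v i<j vi<vj
  isBetween≡0 : ∀ m → isBetween m ≡ 0
  isBetween≡0 m with does (i <? m) in i<m | does (m <? j) in m<j
                 | does (v ⟨$⟩ʳ i <? v ⟨$⟩ʳ m) in vi<vm | does (v ⟨$⟩ʳ m <? v ⟨$⟩ʳ j) in vm<vj
  ... | true  | true  | true  | true  = ⊥-elim (nothing-between m
          (<?-sound i<m , <?-sound m<j , <?-sound vi<vm , <?-sound vm<vj))
  ... | false | _     | _     | _     = refl
  ... | true  | false | _     | _     = refl
  ... | true  | true  | false | _     = refl
  ... | true  | true  | true  | false = refl
  outside-isBetween≡0 : ∀ m → outside i j isBetween m ≡ 0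
  outside-isBetween≡0 m with does (m ≟ i) ∨ does (m ≟ j)
  ... | true  = refl
  ... | false = isBetween≡0 m
  betweenCount≡0 : betweenCount ≡ 0
  betweenCount≡0 = trans (sumℕ-cong outside-isBetween≡0) (sumℕ-zero {n})

len-cong : ∀ {n} {u v : Perm n} → u ≈ₚ v → len u ≡ len v
len-cong u≈v = sumℕ-cong λ p → sumℕ-cong λ q →
  cong₂ (λ x y → 𝟙 (does (p <? q) ∧ does (x <? y))) (u≈v q) (u≈v p)

-- Bruhat order

≤B-respʳ : ∀ {n} {u v v′ : Perm n} → u ≤B v → v ≈ₚ v′ → u ≤B v′
≤B-respʳ (≤B-refl u≈v) v≈v′ = ≤B-refl λ x → trans (u≈v x) (v≈v′ x)
≤B-respʳ {v = v} {v′} (≤B-step {v = w} a b u≤w v≈tw ℓw<ℓv) v≈v′ =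
  ≤B-step a b u≤w (λ x → trans (sym (v≈v′ x)) (v≈tw x))
          (subst (len w ℕ.<_) (len-cong {u = v} {v′} v≈v′) ℓw<ℓv)

≤B-trans : ∀ {n} {u v w : Perm n} → u ≤B v → v ≤B w → u ≤B w
≤B-trans u≤v (≤B-refl v≈w)              = ≤B-respʳ u≤v v≈w
≤B-trans u≤v (≤B-step a b v≤x w≈tx ℓx<ℓw) = ≤B-step a b (≤B-trans u≤v v≤x) w≈tx ℓx<ℓw

≤B-tr-up : ∀ {n} (v : Perm n) {i j a b : Fin n} → v ⟨$⟩ʳ i ≡ a → v ⟨$⟩ʳ j ≡ b →
           i < j → a < b → v ≤B tr a b v
≤B-tr-up v {i} {j} refl refl i<j a<b =
  ≤B-step (v ⟨$⟩ʳ i) (v ⟨$⟩ʳ j) (≤B-refl {w = v} λ _ → refl) (λ _ → refl) (len-<-tr v i<j a<b)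

≤B-tr-down : ∀ {n} (v : Perm n) {i j : Fin n} → i < j → v ⟨$⟩ʳ j < v ⟨$⟩ʳ i →
             tr (v ⟨$⟩ʳ i) (v ⟨$⟩ʳ j) v ≤B v
≤B-tr-down v {i} {j} i<j vj<vi = ≤B-respʳ
  (≤B-tr-up (tr a b v) (transpose-matchˡ a b) (transpose-matchʳ a b) i<j vj<vi)
  (λ x → PC.transpose-inverse b a)
  where
  a = v ⟨$⟩ʳ i
  b = v ⟨$⟩ʳ j

tr-inner≤B-tr-outer : ∀ {n} (v : Perm n) {j m k : Fin n} → j < m → m < k →
  v ⟨$⟩ʳ j < v ⟨$⟩ʳ m → v ⟨$⟩ʳ m < v ⟨$⟩ʳ k →
  tr (v ⟨$⟩ʳ j) (v ⟨$⟩ʳ m) v ≤B tr (v ⟨$⟩ʳ j) (v ⟨$⟩ʳ k) v ×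
  tr (v ⟨$⟩ʳ m) (v ⟨$⟩ʳ k) v ≤B tr (v ⟨$⟩ʳ j) (v ⟨$⟩ʳ k) v
tr-inner≤B-tr-outer v {j} {m} {k} j<m m<k a<c c<b = inner-left , inner-right
  where
  a = v ⟨$⟩ʳ j
  c = v ⟨$⟩ʳ m
  b = v ⟨$⟩ʳ k
  j<k = FinP.<-trans j<m m<k
  a<b = FinP.<-trans a<c c<b
  a≢c = FinP.<⇒≢ a<c
  a≢b = FinP.<⇒≢ a<b
  b≢c = FinP.<⇒≢ c<b ∘ sym
  b≢a = a≢b ∘ sym
  inner-left : tr a c v ≤B tr a b v
  inner-left = ≤B-respʳ (≤B-trans
      (≤B-tr-up (tr a c v) (transpose-matchˡ a c) (transpose-other b≢a b≢c) j<k c<b)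
      (≤B-tr-up (tr c b (tr a c v))
         (trans (cong (PC.transpose c b) (transpose-matchʳ a c)) (transpose-other a≢c a≢b))
         (trans (cong (PC.transpose c b) (transpose-other b≢a b≢c)) (transpose-matchʳ c b))
         m<k a<c))
    λ x → trans (tr-conjugate a c c b v x)
                (cong₂ (λ s t → PC.transpose s t (v ⟨$⟩ʳ x))
                       (transpose-matchʳ a c) (transpose-other b≢a b≢c))
  inner-right : tr c b v ≤B tr a b v
  inner-right = ≤B-respʳ (≤B-trans
      (≤B-tr-up (tr c b v) (transpose-other a≢c a≢b) (transpose-matchʳ c b) j<k a<c)
      (≤B-tr-up (tr a c (tr c b v))
         (trans (cong (PC.transpose a c) (transpose-other a≢c a≢b)) (transpose-matchˡ a c))
         (trans (cong (PC.transpose a c) (transpose-matchˡ c b)) (transpose-other b≢a b≢c))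
         j<m c<b))
    λ x → trans (tr-conjugate c b a c v x)
                (cong₂ (λ s t → PC.transpose s t (v ⟨$⟩ʳ x))
                       (transpose-other a≢c a≢b) (transpose-matchˡ c b))

≤B-unstep : ∀ {n} {u w : Perm n} → u ≤B w →
            u ≈ₚ w ⊎ ∃₂ λ a b → len (tr a b w) ℕ.< len w × u ≤B tr a b w
≤B-unstep (≤B-refl u≈w) = inj₁ u≈w
≤B-unstep {w = w} (≤B-step {v = v} a b u≤v w≈tv ℓv<ℓw) =
  inj₂ (a , b , subst (ℕ._< len w) (len-cong {u = v} {tr a b w} v≈tw) ℓv<ℓw , ≤B-respʳ u≤v v≈tw)
  where
  v≈tw : v ≈ₚ tr a b w
  v≈tw x = trans (sym (transpose-involutive a b (v ⟨$⟩ʳ x))) (cong (PC.transpose a b) (sym (w≈tv x)))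

≈ₚ? : ∀ {n} (u v : Perm n) → Dec (u ≈ₚ v)
≈ₚ? u v = FinP.all? λ x → u ⟨$⟩ʳ x ≟ v ⟨$⟩ʳ x

_≤B?_ : ∀ {n} (u w : Perm n) → Dec (u ≤B w)
_≤B?_ {n} u w = bounded (suc (len w)) w (ℕP.n<1+n (len w))
  where
  bounded : ∀ fuel (w : Perm n) → len w ℕ.< fuel → Dec (u ≤B w)
  bounded (suc fuel) w ℓw<fuel with ≈ₚ? u w
  ... | yes u≈w = yes (≤B-refl u≈w)
  ... | no u≉w  = map′ step-down
                       (λ u≤w → [ (λ u≈w → contradiction u≈w u≉w) , (λ below → below) ]′ (≤B-unstep u≤w))
                       (FinP.any? λ a → FinP.any? λ b → below? a b)
    where
    below? : ∀ a b → Dec (len (tr a b w) ℕ.< len w × u ≤B tr a b w)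
    below? a b with len (tr a b w) ℕ.<? len w
    ... | no ℓ≮ = no (ℓ≮ ∘ proj₁)
    ... | yes ℓ< = map′ (ℓ< ,_) proj₂ (bounded fuel (tr a b w) (ℕP.<-≤-trans ℓ< (ℕP.≤-pred ℓw<fuel)))
    step-down : (∃₂ λ a b → len (tr a b w) ℕ.< len w × u ≤B tr a b w) → u ≤B w
    step-down (a , b , ℓ< , u≤tw) = ≤B-step a b u≤tw (λ x → sym (transpose-involutive a b (w ⟨$⟩ʳ x))) ℓ<

-- Decomposability

Etilde? : ∀ {n} (w u : Perm n) (a b : Fin n) → Dec (Etilde w u a b)
Etilde? w u a b = FinP.any? λ i → FinP.any? λ j →
  i <? j ×-dec u ⟨$⟩ʳ i ≟ a ×-dec u ⟨$⟩ʳ j ≟ b ×-dec tr a b u ≤B? w ×-dec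
  (len (tr a b u) ℕ.≟ suc (len u) ⊎-dec len u ℕ.≟ suc (len (tr a b u)))

position : ∀ {n} → Perm n → Fin n → Fin n
position u x = u ⟨$⟩ˡ x

position-⟨$⟩ʳ : ∀ {n} (u : Perm n) {i x} → u ⟨$⟩ʳ i ≡ x → position u x ≡ i
position-⟨$⟩ʳ u refl = inverseˡ u

Etilde-position< : ∀ {n} {w u : Perm n} {x y} → Etilde w u x y → position u x < position u y
Etilde-position< {u = u} (i , j , i<j , ui≡x , uj≡y , _) =
  subst₂ _<_ (sym (position-⟨$⟩ʳ u ui≡x)) (sym (position-⟨$⟩ʳ u uj≡y)) i<j

Chain-rank< : ∀ {n} {R : Fin n → Fin n → Set} (rank : Fin n → Fin n) →
              (∀ {x y} → R x y → rank x < rank y) → ∀ {x y} → Chain R x y → rank x < rank y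
Chain-rank< rank rank-< (one r)    = rank-< r
Chain-rank< rank rank-< (cons r c) = FinP.<-trans (rank-< r) (Chain-rank< rank rank-< c)

module ChainDecidable {n} {R : Fin n → Fin n → Set} (R? : ∀ x y → Dec (R x y))
                      (rank : Fin n → Fin n) (rank-< : ∀ {x y} → R x y → rank x < rank y) where

  ShortChain : ℕ → Fin n → Fin n → Set
  ShortChain zero    x y = R x y
  ShortChain (suc k) x y = R x y ⊎ Σ (Fin n) λ z → R x z × ShortChain k z y

  ShortChain? : ∀ k x y → Dec (ShortChain k x y)
  ShortChain? zero    x y = R? x y
  ShortChain? (suc k) x y = R? x y ⊎-dec FinP.any? λ z → R? x z ×-dec ShortChain? k z y

  ShortChain⇒Chain : ∀ k {x y} → ShortChain k x y → Chain R x y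
  ShortChain⇒Chain zero    r                = one r
  ShortChain⇒Chain (suc k) (inj₁ r)         = one r
  ShortChain⇒Chain (suc k) (inj₂ (_ , r , c)) = cons r (ShortChain⇒Chain k c)

  -- ranks increase strictly along a chain, so one starting at x has at most n ∸ rank x links
  Chain⇒ShortChain : ∀ {x y} → Chain R x y → ∀ k → n ℕ.≤ k + suc (Fin.toℕ (rank x)) → ShortChain k x y
  Chain⇒ShortChain (one r) zero    _ = r
  Chain⇒ShortChain (one r) (suc k) _ = inj₁ r
  Chain⇒ShortChain (cons {c = z} r c) zero n≤rx =
    contradiction (ℕP.≤-trans (FinP.toℕ<n (rank z)) (ℕP.≤-trans n≤rx (rank-< r))) (ℕP.<-irrefl refl)
  Chain⇒ShortChain {x} (cons {c = z} r c) (suc k) n≤k+rx =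
    inj₂ (z , r , Chain⇒ShortChain c k (ℕP.≤-trans n≤k+rx (begin
      suc k + suc (Fin.toℕ (rank x)) ≡⟨ sym (ℕP.+-suc k (suc (Fin.toℕ (rank x)))) ⟩
      k + suc (suc (Fin.toℕ (rank x))) ≤⟨ ℕP.+-monoʳ-≤ k (ℕ.s≤s (rank-< r)) ⟩
      k + suc (Fin.toℕ (rank z)) ∎)))
    where open ℕP.≤-Reasoning

  Chain? : ∀ x y → Dec (Chain R x y)
  Chain? x y = map′ (ShortChain⇒Chain n) (λ c → Chain⇒ShortChain c n (ℕP.m≤m+n n _)) (ShortChain? n x y)

EtildeExcept : ∀ {n} → Perm n → Perm n → Fin n → Fin n → Fin n → Fin n → Set
EtildeExcept w u a b x y = Etilde w u x y × ¬ (x ≡ a × y ≡ b)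

Decomposable? : ∀ {n} (w u : Perm n) a b → Dec (Decomposable w u a b)
Decomposable? w u a b = FinP.any? λ c → EtildeExcept? a c ×-dec Chain? c b
  where
  EtildeExcept? : ∀ x y → Dec (EtildeExcept w u a b x y)
  EtildeExcept? x y = Etilde? w u x y ×-dec ¬? (x ≟ a ×-dec y ≟ b)
  open ChainDecidable EtildeExcept? (position u) (Etilde-position< {w = w} {u} ∘ proj₁)

-- Cones

module Σℚ = SemiringSum (CommutativeRing.semiring QP.+-*-commutativeRing)

sumℚ≡sum : ∀ {n} (f : Fin n → ℚ) → sumℚ f ≡ Σℚ.sum f
sumℚ≡sum {zero}  f = refl
sumℚ≡sum {suc n} f = cong (f zero ℚ.+_) (sumℚ≡sum (f ∘ suc))

sumℚ-cong : ∀ {n} {f g : Fin n → ℚ} → (∀ i → f i ≡ g i) → sumℚ f ≡ sumℚ g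
sumℚ-cong {f = f} {g} f≗g =
  trans (sumℚ≡sum f) (trans (Σℚ.sum-cong-≗ f≗g) (sym (sumℚ≡sum g)))

sumℚ-+ : ∀ {n} (f g : Fin n → ℚ) → sumℚ (λ i → f i ℚ.+ g i) ≡ sumℚ f ℚ.+ sumℚ g
sumℚ-+ f g = begin
  sumℚ (λ i → f i ℚ.+ g i)    ≡⟨ sumℚ≡sum (λ i → f i ℚ.+ g i) ⟩
  Σℚ.sum (λ i → f i ℚ.+ g i)  ≡⟨ Σℚ.∑-distrib-+ f g ⟩
  Σℚ.sum f ℚ.+ Σℚ.sum g       ≡⟨ sym (cong₂ ℚ._+_ (sumℚ≡sum f) (sumℚ≡sum g)) ⟩
  sumℚ f ℚ.+ sumℚ g           ∎
  where open ≡-Reasoning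

*-distribˡ-sumℚ : ∀ {n} q (f : Fin n → ℚ) → q ℚ.* sumℚ f ≡ sumℚ (λ i → q ℚ.* f i)
*-distribˡ-sumℚ q f = begin
  q ℚ.* sumℚ f                ≡⟨ cong (q ℚ.*_) (sumℚ≡sum f) ⟩
  q ℚ.* Σℚ.sum f              ≡⟨ Σℚ.*-distribˡ-sum q f ⟩
  Σℚ.sum (λ i → q ℚ.* f i)    ≡⟨ sym (sumℚ≡sum (λ i → q ℚ.* f i)) ⟩
  sumℚ (λ i → q ℚ.* f i)      ∎
  where open ≡-Reasoning

sumℚ-zero : ∀ {n} → sumℚ {n} (λ _ → 0ℚ) ≡ 0ℚ
sumℚ-zero {n} = trans (sumℚ≡sum {n} (λ _ → 0ℚ)) (Σℚ.sum-replicate-zero n)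

sumℚ-e* : ∀ {n} (a : Fin n) (f : Fin n → ℚ) → sumℚ (λ x → e a x ℚ.* f x) ≡ f a
sumℚ-e* {suc n} zero f = begin
  1ℚ ℚ.* f zero ℚ.+ sumℚ (λ x → 0ℚ ℚ.* f (suc x))
    ≡⟨ cong₂ ℚ._+_ (QP.*-identityˡ (f zero)) (sumℚ-cong (λ x → QP.*-zeroˡ (f (suc x)))) ⟩
  f zero ℚ.+ sumℚ {n} (λ _ → 0ℚ)
    ≡⟨ trans (cong (f zero ℚ.+_) (sumℚ-zero {n})) (QP.+-identityʳ (f zero)) ⟩
  f zero ∎
  where open ≡-Reasoning
sumℚ-e* {suc n} (suc a) f =
  trans (cong₂ ℚ._+_ (QP.*-zeroˡ (f zero)) (sumℚ-e* a (f ∘ suc))) (QP.+-identityˡ (f (suc a)))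

root : ∀ {n} → Fin n → Fin n → Fin n → ℚ
root a b k = e b k - e a k

root-trans : ∀ {n} (a c b k : Fin n) → root a c k ℚ.+ root c b k ≡ root a b k
root-trans a c b k = solve 3 (λ x y z → (z :- x) :+ (y :- z) := y :- x) refl (e a k) (e b k) (e c k)

combination : ∀ {n} → (Fin n → Fin n → ℚ) → Fin n → ℚ
combination c k = sumℚ (λ x → sumℚ (λ y → c x y ℚ.* root x y k))

combination-+ : ∀ {n} (c₁ c₂ : Fin n → Fin n → ℚ) k →
  combination (λ x y → c₁ x y ℚ.+ c₂ x y) k ≡ combination c₁ k ℚ.+ combination c₂ k
combination-+ c₁ c₂ k = begin
  sumℚ (λ x → sumℚ (λ y → (c₁ x y ℚ.+ c₂ x y) ℚ.* root x y k))
    ≡⟨ sumℚ-cong (λ x → sumℚ-cong (λ y → QP.*-distribʳ-+ (root x y k) (c₁ x y) (c₂ x y))) ⟩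
  sumℚ (λ x → sumℚ (λ y → c₁ x y ℚ.* root x y k ℚ.+ c₂ x y ℚ.* root x y k))
    ≡⟨ sumℚ-cong (λ x → sumℚ-+ (λ y → c₁ x y ℚ.* root x y k) (λ y → c₂ x y ℚ.* root x y k)) ⟩
  sumℚ (λ x → sumℚ (λ y → c₁ x y ℚ.* root x y k) ℚ.+ sumℚ (λ y → c₂ x y ℚ.* root x y k))
    ≡⟨ sumℚ-+ (λ x → sumℚ (λ y → c₁ x y ℚ.* root x y k)) (λ x → sumℚ (λ y → c₂ x y ℚ.* root x y k)) ⟩
  combination c₁ k ℚ.+ combination c₂ k ∎
  where open ≡-Reasoning

module _ {n} {R : Fin n → Fin n → Set} where

  InCone-root : ∀ {a b} → R a b → InCone R (root a b)
  InCone-root {a} {b} r = c , c≥0 , c-support , c-sum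
    where
    c : Fin n → Fin n → ℚ
    c x y = e a x ℚ.* e b y
    c≥0 : ∀ x y → 0ℚ ℚ.≤ c x y
    c≥0 x y with does (x ≟ a) | does (y ≟ b)
    ... | true  | true  = QP.nonNegative⁻¹ 1ℚ
    ... | true  | false = QP.≤-refl
    ... | false | true  = QP.≤-refl
    ... | false | false = QP.≤-refl
    c-support : ∀ x y → c x y ≡ 0ℚ ⊎ R x y
    c-support x y with x ≟ a | y ≟ b
    ... | yes refl | yes refl = inj₂ r
    ... | yes _    | no _     = inj₁ (QP.*-zeroʳ 1ℚ)
    ... | no _     | y≟b      = inj₁ (QP.*-zeroˡ (if does y≟b then 1ℚ else 0ℚ))
    c-sum : ∀ k → root a b k ≡ combination c k
    c-sum k = sym (begin
      sumℚ (λ x → sumℚ (λ y → e a x ℚ.* e b y ℚ.* root x y k))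
        ≡⟨ sumℚ-cong (λ x → trans (sumℚ-cong (λ y → QP.*-assoc (e a x) (e b y) (root x y k)))
                                  (sym (*-distribˡ-sumℚ (e a x) (λ y → e b y ℚ.* root x y k)))) ⟩
      sumℚ (λ x → e a x ℚ.* sumℚ (λ y → e b y ℚ.* root x y k))
        ≡⟨ sumℚ-e* a (λ x → sumℚ (λ y → e b y ℚ.* root x y k)) ⟩
      sumℚ (λ y → e b y ℚ.* root a y k)
        ≡⟨ sumℚ-e* b (λ y → root a y k) ⟩
      root a b k ∎)
      where open ≡-Reasoning

  InCone-+ : ∀ {v₁ v₂} → InCone R v₁ → InCone R v₂ → InCone R (λ k → v₁ k ℚ.+ v₂ k)
  InCone-+ {v₁} {v₂} (c₁ , c₁≥0 , c₁-support , c₁-sum) (c₂ , c₂≥0 , c₂-support , c₂-sum) =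
    c , c≥0 , c-support , c-sum
    where
    c : Fin n → Fin n → ℚ
    c x y = c₁ x y ℚ.+ c₂ x y
    c≥0 : ∀ x y → 0ℚ ℚ.≤ c x y
    c≥0 x y = subst (ℚ._≤ c x y) (QP.+-identityˡ 0ℚ) (QP.+-mono-≤ (c₁≥0 x y) (c₂≥0 x y))
    c-support : ∀ x y → c x y ≡ 0ℚ ⊎ R x y
    c-support x y with c₁-support x y | c₂-support x y
    ... | inj₂ r   | _        = inj₂ r
    ... | inj₁ _   | inj₂ r   = inj₂ r
    ... | inj₁ c₁0 | inj₁ c₂0 = inj₁ (trans (cong₂ ℚ._+_ c₁0 c₂0) (QP.+-identityˡ 0ℚ))
    c-sum : ∀ k → v₁ k ℚ.+ v₂ k ≡ combination c k
    c-sum k = trans (cong₂ ℚ._+_ (c₁-sum k) (c₂-sum k)) (sym (combination-+ c₁ c₂ k))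

  InCone-cong : ∀ {v₁ v₂} → (∀ k → v₁ k ≡ v₂ k) → InCone R v₁ → InCone R v₂
  InCone-cong v₁≗v₂ (c , c≥0 , c-support , c-sum) =
    c , c≥0 , c-support , λ k → trans (sym (v₁≗v₂ k)) (c-sum k)

  InCone-root-trans : ∀ {a b c} → InCone R (root a c) → InCone R (root c b) → InCone R (root a b)
  InCone-root-trans {a} {b} {c} a→c c→b = InCone-cong (root-trans a c b) (InCone-+ a→c c→b)

-- Induction on the gap between positions

fuel-shrinkʳ : ∀ D {j k p q} → k ℕ.≤ suc D + j → j ℕ.≤ p → q ℕ.< k → q ℕ.≤ D + p
fuel-shrinkʳ D k≤ j≤p q<k = ℕP.≤-trans (ℕP.≤-pred (ℕP.≤-trans q<k k≤)) (ℕP.+-monoʳ-≤ D j≤p)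

fuel-shrinkˡ : ∀ D {j k p q} → k ℕ.≤ suc D + j → j ℕ.< p → q ℕ.≤ k → q ℕ.≤ D + p
fuel-shrinkˡ D {j} {p = p} k≤ j<p q≤k =
  ℕP.≤-trans q≤k (ℕP.≤-trans k≤ (subst (ℕ._≤ D + p) (ℕP.+-suc D j) (ℕP.+-monoʳ-≤ D j<p)))

module _ {n} {w u : Perm n} (u≤w : u ≤B w) where

  SwapBelow : Fin n → Fin n → Set
  SwapBelow p q = tr (u ⟨$⟩ʳ p) (u ⟨$⟩ʳ q) u ≤B w

  RootInD : Fin n → Fin n → Set
  RootInD p q = InD w u (root (u ⟨$⟩ʳ p) (u ⟨$⟩ʳ q))

  ValueBetween : Fin n → Fin n → Fin n → Set
  ValueBetween j k m = j < m × m < k ×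
    (u ⟨$⟩ʳ j < u ⟨$⟩ʳ m × u ⟨$⟩ʳ m < u ⟨$⟩ʳ k ⊎ u ⟨$⟩ʳ k < u ⟨$⟩ʳ m × u ⟨$⟩ʳ m < u ⟨$⟩ʳ j)

  ValueBetween? : ∀ j k m → Dec (ValueBetween j k m)
  ValueBetween? j k m = j <? m ×-dec m <? k ×-dec
    (u ⟨$⟩ʳ j <? u ⟨$⟩ʳ m ×-dec u ⟨$⟩ʳ m <? u ⟨$⟩ʳ k ⊎-dec
     u ⟨$⟩ʳ k <? u ⟨$⟩ʳ m ×-dec u ⟨$⟩ʳ m <? u ⟨$⟩ʳ j)

  ≤B-split : ∀ {j k m} → ValueBetween j k m → SwapBelow j k → SwapBelow j m × SwapBelow m k
  ≤B-split (j<m , m<k , inj₁ (uj<um , um<uk)) tw with tr-inner≤B-tr-outer u j<m m<k uj<um um<uk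
  ... | left , right = ≤B-trans left tw , ≤B-trans right tw
  ≤B-split (j<m , m<k , inj₂ (uk<um , um<uj)) _ =
    ≤B-trans (≤B-tr-down u j<m um<uj) u≤w , ≤B-trans (≤B-tr-down u m<k uk<um) u≤w

  len-tr-±1 : ∀ {j k} → j < k → (∀ m → ¬ ValueBetween j k m) →
              len (tr (u ⟨$⟩ʳ j) (u ⟨$⟩ʳ k) u) ≡ suc (len u) ⊎
              len u ≡ suc (len (tr (u ⟨$⟩ʳ j) (u ⟨$⟩ʳ k) u))
  len-tr-±1 {j} {k} j<k nothing-between with FinP.<-cmp (u ⟨$⟩ʳ j) (u ⟨$⟩ʳ k)
  ... | tri< uj<uk _ _ = inj₁ (len-tr-cover u refl refl j<k uj<uk
          λ m (j<m , m<k , uj<um , um<uk) → nothing-between m (j<m , m<k , inj₁ (uj<um , um<uk)))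
  ... | tri≈ _ uj≡uk _ = contradiction (⟨$⟩ʳ-injective u uj≡uk) (FinP.<⇒≢ j<k)
  ... | tri> _ _ uk<uj = inj₂ (trans
          (sym (len-cong {u = tr b a u′} {u} (λ x → PC.transpose-inverse b a)))
          (len-tr-cover u′ (transpose-matchˡ a b) (transpose-matchʳ a b) j<k uk<uj
            λ m (j<m , m<k , b<u′m , u′m<a) → nothing-between m
              (j<m , m<k , inj₂ (subst (b <_) (u′-m j<m m<k) b<u′m ,
                                 subst (_< a) (u′-m j<m m<k) u′m<a))))
    where
    a = u ⟨$⟩ʳ j
    b = u ⟨$⟩ʳ k
    u′ = tr a b u
    u′-m : ∀ {m} → j < m → m < k → u′ ⟨$⟩ʳ m ≡ u ⟨$⟩ʳ m
    u′-m j<m m<k = transpose-other (FinP.<⇒≢ j<m ∘ sym ∘ ⟨$⟩ʳ-injective u)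
                                   (FinP.<⇒≢ m<k ∘ ⟨$⟩ʳ-injective u)

  module WithinInterval (lo hi : Fin n)
    (inside : ∀ {p q} → p < q → lo Fin.≤ p → q Fin.≤ hi →
              SwapBelow p q → RootInD p q) where

    Etilde-InD : ∀ {x y} → Etilde w u x y → lo Fin.≤ position u x → position u y Fin.≤ hi →
                 InD w u (root x y)
    Etilde-InD (p , q , p<q , refl , refl , tw , _) lo≤p q≤hi =
      inside p<q (subst (lo Fin.≤_) (position-⟨$⟩ʳ u refl) lo≤p)
                 (subst (Fin._≤ hi) (position-⟨$⟩ʳ u refl) q≤hi) tw

    Chain-InD : ∀ {a b x y} → Chain (EtildeExcept w u a b) x y →
                lo Fin.≤ position u x → position u y Fin.≤ hi → InD w u (root x y)
    Chain-InD (one o) = Etilde-InD (proj₁ o)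
    Chain-InD (cons o c) lo≤x y≤hi = InCone-root-trans
      (Etilde-InD (proj₁ o) lo≤x
        (FinP.≤-trans (ℕP.<⇒≤ (Chain-rank< (position u) (Etilde-position< {w = w} {u} ∘ proj₁) c)) y≤hi))
      (Chain-InD c (FinP.≤-trans lo≤x (ℕP.<⇒≤ (Etilde-position< {w = w} {u} (proj₁ o)))) y≤hi)

  root-InD : ∀ D {j k} → j < k → Fin.toℕ k ℕ.≤ D + Fin.toℕ j →
             SwapBelow j k → RootInD j k
  root-InD zero    j<k k≤j _ = contradiction k≤j (ℕP.<⇒≱ j<k)
  root-InD (suc D) {j} {k} j<k k≤ tw with FinP.any? (ValueBetween? j k)
  ... | yes (m , between@(j<m , m<k , _)) = InCone-root-trans
          (root-InD D j<m (fuel-shrinkʳ D k≤ ℕP.≤-refl m<k) (proj₁ (≤B-split between tw)))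
          (root-InD D m<k (fuel-shrinkˡ D k≤ j<m ℕP.≤-refl) (proj₂ (≤B-split between tw)))
  ... | no nothing-between with Decomposable? w u (u ⟨$⟩ʳ j) (u ⟨$⟩ʳ k)
  ...   | no indecomposable =
          InCone-root ((j , k , j<k , refl , refl , tw , len-tr-±1 j<k (λ m b → nothing-between (m , b)))
                      , indecomposable)
  ...   | yes (c , a→c , c→b) = InCone-root-trans
          (WithinInterval.Etilde-InD j (position u c) below-c (proj₁ a→c)
             (FinP.≤-reflexive (sym (position-⟨$⟩ʳ u refl))) FinP.≤-refl)
          (WithinInterval.Chain-InD (position u c) k above-c c→b
             FinP.≤-refl (FinP.≤-reflexive (position-⟨$⟩ʳ u refl)))
    where
    j<c : j < position u c
    j<c = subst (_< position u c) (position-⟨$⟩ʳ u refl) (Etilde-position< {w = w} {u} (proj₁ a→c))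
    c<k : position u c < k
    c<k = subst (position u c <_) (position-⟨$⟩ʳ u refl)
            (Chain-rank< (position u) (Etilde-position< {w = w} {u} ∘ proj₁) c→b)
    below-c : ∀ {p q} → p < q → j Fin.≤ p → q Fin.≤ position u c →
              SwapBelow p q → RootInD p q
    below-c p<q j≤p q≤c = root-InD D p<q (fuel-shrinkʳ D k≤ j≤p (ℕP.≤-<-trans q≤c c<k))
    above-c : ∀ {p q} → p < q → position u c Fin.≤ p → q Fin.≤ k →
              SwapBelow p q → RootInD p q
    above-c p<q c≤p q≤k = root-InD D p<q (fuel-shrinkˡ D k≤ (ℕP.<-≤-trans j<c c≤p) q≤k)

lemma7p11 : (n : ℕ) (w u : Perm n) → u ≤B w →
    (j k : Fin n) → j < k → tr (u ⟨$⟩ʳ j) (u ⟨$⟩ʳ k) u ≤B w →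
    InD w u (λ i → e (u ⟨$⟩ʳ k) i - e (u ⟨$⟩ʳ j) i)
lemma7p11 n w u u≤w j k j<k tw = root-InD u≤w (Fin.toℕ k) j<k (ℕP.m≤m+n (Fin.toℕ k) (Fin.toℕ j)) tw
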